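{- Let $v,v',v''\in\mathbb{YF}$ with $v=v'v''$. Then $\pi(v)=\pi(v'')\,\pi\bigl(v'1^{|v''|}\bigr)$.
   Context: Words are finite words over $\{1,2\}$; $\mathbb{YF}$ is the set of all finite words; $|x|$ is the digit sum and $d(x)$ the number of $2$'s of $x$; concatenation is $xy$ and $1^k$ is the word of $k$ letters $1$. For $1\le i\le d(x)$, $g(x,i)=1+$ (digit sum of the part of $x$ strictly to the right of the $i$-th letter $2$ of $x$, counting $2$'s from the right). $\pi(x)=\prod_{i:\,g(x,i)>1}\frac{g(x,i)-1}{g(x,i)}$ (empty product $=1$). -}

module Defs where

open import Data.Nat using (ℕ; zero; suc; _+_; _*_)
open import Data.List using (List; []; _∷_; _++_; length; replicate)
open import Data.Fin using (Fin)
open import Data.List using (lookup)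
open import Data.Integer using (+_)
open import Data.Rational using (ℚ; _/_; 1ℚ) renaming (_*_ to _*ℚ_)

data Letter : Set where
  one two : Letter

Word : Set
Word = List Letter

val : Letter → ℕ
val one = 1
val two = 2

∣_∣ : Word → ℕ
∣ [] ∣ = 0
∣ a ∷ w ∣ = val a + ∣ w ∣

d : Word → ℕ
d [] = 0
d (one ∷ w) = d w
d (two ∷ w) = suc (d w)

ones : ℕ → Word
ones k = replicate k one

-- The list (g(x,1), ..., g(x,d(x))): the i-th entry is 1 + digit sum of the
-- part of x strictly right of the i-th letter 2 of x, counting 2's from the right.
gList : Word → List ℕ
gList [] = []
gList (one ∷ w) = gList w
gList (two ∷ w) = gList w ++ (suc ∣ w ∣ ∷ [])

-- g(x,i) for 1 ≤ i ≤ d(x), with i represented by Fin (length (gList x))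
-- (i = 1 corresponds to Fin.zero); length (gList x) = d x.
g : (x : Word) → Fin (length (gList x)) → ℕ
g x i = lookup (gList x) i

factor : ℕ → ℚ
factor zero = 1ℚ
factor (suc zero) = 1ℚ
factor (suc (suc n)) = (+ suc n) / suc (suc n)

prodℚ : List ℚ → ℚ
prodℚ [] = 1ℚ
prodℚ (q ∷ qs) = q *ℚ prodℚ qs

mapL : {A B : Set} → (A → B) → List A → List B
mapL f [] = []
mapL f (a ∷ as) = f a ∷ mapL f as

π : Word → ℚ
π x = prodℚ (mapL factor (gList x))

-- The g-values of v′v″ are those of v″ followed by those of v′, each shifted by
-- |v″|; padding v′ with 1's of total sum |v″| produces exactly the same shift
-- while contributing no 2's. Since π is a product over the g-values, it splits.
module Submission where

open import Defs
open import Data.List using (_++_)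
open import Relation.Binary.PropositionalEquality using (_≡_)
open import Data.Rational using (_*_)

open import Data.Nat using (ℕ; zero; suc; _+_)
open import Data.Nat.Properties using (+-assoc)
open import Data.List using (List; []; _∷_)
open import Data.List.Properties using (++-assoc; ++-identityʳ)
open import Data.Rational using (ℚ)
open import Data.Rational.Properties using (*-assoc; *-identityˡ)
open import Relation.Binary.PropositionalEquality
  using (refl; sym; trans; cong; cong₂; module ≡-Reasoning)

gListShifted : Word → ℕ → List ℕ
gListShifted [] k = []
gListShifted (one ∷ w) k = gListShifted w k
gListShifted (two ∷ w) k = gListShifted w k ++ suc (∣ w ∣ + k) ∷ []

∣∣-++ : ∀ v w → ∣ v ++ w ∣ ≡ ∣ v ∣ + ∣ w ∣
∣∣-++ [] w = refl
∣∣-++ (a ∷ v) w = trans (cong (val a +_) (∣∣-++ v w)) (sym (+-assoc (val a) ∣ v ∣ ∣ w ∣))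

∣ones∣ : ∀ k → ∣ ones k ∣ ≡ k
∣ones∣ zero = refl
∣ones∣ (suc k) = cong suc (∣ones∣ k)

gList-ones : ∀ k → gList (ones k) ≡ []
gList-ones zero = refl
gList-ones (suc k) = gList-ones k

gList-++ : ∀ v w → gList (v ++ w) ≡ gList w ++ gListShifted v ∣ w ∣
gList-++ [] w = sym (++-identityʳ (gList w))
gList-++ (one ∷ v) w = gList-++ v w
gList-++ (two ∷ v) w = begin
  gList (v ++ w) ++ suc ∣ v ++ w ∣ ∷ []
    ≡⟨ cong₂ (λ l s → l ++ suc s ∷ []) (gList-++ v w) (∣∣-++ v w) ⟩
  (gList w ++ gListShifted v ∣ w ∣) ++ suc (∣ v ∣ + ∣ w ∣) ∷ []
    ≡⟨ ++-assoc (gList w) (gListShifted v ∣ w ∣) _ ⟩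
  gList w ++ gListShifted v ∣ w ∣ ++ suc (∣ v ∣ + ∣ w ∣) ∷ [] ∎
  where open ≡-Reasoning

gList-++-ones : ∀ v k → gList (v ++ ones k) ≡ gListShifted v k
gList-++-ones v k = begin
  gList (v ++ ones k)                            ≡⟨ gList-++ v (ones k) ⟩
  gList (ones k) ++ gListShifted v ∣ ones k ∣    ≡⟨ cong₂ _++_ (gList-ones k) (cong (gListShifted v) (∣ones∣ k)) ⟩
  gListShifted v k                               ∎
  where open ≡-Reasoning

mapL-++ : ∀ {A B : Set} (f : A → B) xs ys → mapL f (xs ++ ys) ≡ mapL f xs ++ mapL f ys
mapL-++ f [] ys = refl
mapL-++ f (x ∷ xs) ys = cong (f x ∷_) (mapL-++ f xs ys)

prodℚ-++ : ∀ xs ys → prodℚ (xs ++ ys) ≡ prodℚ xs * prodℚ ys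
prodℚ-++ [] ys = sym (*-identityˡ _)
prodℚ-++ (x ∷ xs) ys = trans (cong (x *_) (prodℚ-++ xs ys)) (sym (*-assoc x _ _))

prodFactor : List ℕ → ℚ
prodFactor gs = prodℚ (mapL factor gs)

prodFactor-++ : ∀ xs ys → prodFactor (xs ++ ys) ≡ prodFactor xs * prodFactor ys
prodFactor-++ xs ys =
  trans (cong prodℚ (mapL-++ factor xs ys)) (prodℚ-++ (mapL factor xs) (mapL factor ys))

mainTheorem14 : (v v′ v″ : Word) → v ≡ v′ ++ v″ →
    π v ≡ π v″ * π (v′ ++ ones ∣ v″ ∣)
mainTheorem14 .(v′ ++ v″) v′ v″ refl = begin
  prodFactor (gList (v′ ++ v″))                           ≡⟨ cong prodFactor (gList-++ v′ v″) ⟩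
  prodFactor (gList v″ ++ gListShifted v′ ∣ v″ ∣)         ≡⟨ prodFactor-++ (gList v″) _ ⟩
  π v″ * prodFactor (gListShifted v′ ∣ v″ ∣)              ≡⟨ cong (λ gs → π v″ * prodFactor gs) (sym (gList-++-ones v′ ∣ v″ ∣)) ⟩
  π v″ * π (v′ ++ ones ∣ v″ ∣)                            ∎
  where open ≡-Reasoning
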